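{- Assume the hypotheses listed in the context. Let $p_1,p_2\colon E\to\mu\Sigma$ be the kernel pair of $\mathrm{coit}\,\iota^\clubsuit\colon\mu\Sigma\to Z$, let $p_i^\star=\hat\iota\circ\Sigma^\star p_i\colon\Sigma^\star E\to\mu\Sigma$ ($i=1,2$), let $c\colon\mu\Sigma\to Q$ be a coequalizer of $p_1^\star,p_2^\star$, and let $\iota_\sim\colon\Sigma Q\to Q$ be the unique morphism with $\iota_\sim\circ\Sigma c=c\circ\iota$ (so that $c=(\!|\iota_\sim|\!)$). Then there exists a morphism $\varsigma\colon Q\to B(Q,Q)$ such that $\varsigma\circ c=\iota_\sim^\clubsuit$, where $\iota_\sim^\clubsuit$ denotes $(\iota_\sim)^\clubsuit\colon\mu\Sigma\to B(Q,Q)$.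
   Context: Hypotheses: $\mathbb{C}$ is a regular category with finite limits and finite colimits, $V$ an object of $\mathbb{C}$, $\Sigma=V+\Sigma'\colon\mathbb{C}\to\mathbb{C}$ with $\Sigma'$ admitting free algebras (so the free monad $\Sigma^\star$ with unit $\eta$ exists), $\Sigma$ preserves reflexive coequalizers, $B\colon\mathbb{C}^{\mathsf{op}}\times\mathbb{C}\to\mathbb{C}$ preserves monomorphisms (i.e. $B(f,g)$ is monic whenever $f$ is epic and $g$ is monic), $\rho$ is a $V$-pointed higher-order GSOS law of $\Sigma$ over $B$, and $B(\mu\Sigma,-)$ has a final coalgebra $(Z,\zeta)$; $\mathrm{coit}\,\iota^\clubsuit$ is the unique coalgebra morphism from $(\mu\Sigma,\iota^\clubsuit)$ to $(Z,\zeta)$. (The pair $p_1^\star,p_2^\star$ is reflexive, and since $\Sigma$ preserves its coequalizer, $\Sigma c$ is a coequalizer of $\Sigma p_1^\star,\Sigma p_2^\star$, which is what makes $\iota_\sim$ well defined.) Notation: $(\mu\Sigma,\iota)$ initial $\Sigma$-algebra; $(\!|a|\!)$ unique algebra morphism from $\mu\Sigma$ into $(A,a)$; $\hat a\colon\Sigma^\star A\to A$ unique algebra morphism extending $\mathrm{id}_A$; $\nabla$ codiagonal; $V/\mathbb{C}$ coslice category with forgetful functor $j$; each $\Sigma$-algebra $(A,a)$ is $V$-pointed via $a\circ\mathrm{inl}$. A $V$-pointed higher-order GSOS law is a family $\rho_{X,Y}\colon\Sigma(jX\times B(jX,Y))\to B(jX,\Sigma^\star(jX+Y))$ dinatural in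 $X\in V/\mathbb{C}$ and natural in $Y\in\mathbb{C}$. For a $\Sigma$-algebra $(A,a)$, $a^\clubsuit\colon\mu\Sigma\to B(A,A)$ is the unique morphism with $a^\clubsuit\circ\iota=B(\mathrm{id},\hat a)\circ B(\mathrm{id},\Sigma^\star\nabla)\circ\rho_{A,A}\circ\Sigma\langle(\!|a|\!),a^\clubsuit\rangle$; $\iota^\clubsuit$ is the case $(A,a)=(\mu\Sigma,\iota)$. -}

module Defs where

open import Level using (Level; _⊔_) renaming (suc to lsuc)
open import Data.Product using (Σ; Σ-syntax; _,_)
open import Relation.Binary using (Rel; IsEquivalence)

record Category (o ℓ e : Level) : Set (lsuc (o ⊔ ℓ ⊔ e)) where
  infixr 9 _∘_
  infix  4 _≈_
  infixr 2 _⇒_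
  field
    Obj  : Set o
    _⇒_  : Obj → Obj → Set ℓ
    _≈_  : ∀ {A B} → Rel (A ⇒ B) e
    id   : ∀ {A} → A ⇒ A
    _∘_  : ∀ {A B C} → B ⇒ C → A ⇒ B → A ⇒ C
    equiv     : ∀ {A B} → IsEquivalence (_≈_ {A} {B})
    assoc     : ∀ {A B C D} {f : A ⇒ B} {g : B ⇒ C} {h : C ⇒ D} →
                (h ∘ g) ∘ f ≈ h ∘ (g ∘ f)
    identityˡ : ∀ {A B} {f : A ⇒ B} → id ∘ f ≈ f
    identityʳ : ∀ {A B} {f : A ⇒ B} → f ∘ id ≈ f
    ∘-resp-≈  : ∀ {A B C} {f h : B ⇒ C} {g i : A ⇒ B} →
                f ≈ h → g ≈ i → f ∘ g ≈ h ∘ i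

module Notions {o ℓ e : Level} (C : Category o ℓ e) where
  open Category C

  Mono : ∀ {A B} → A ⇒ B → Set (o ⊔ ℓ ⊔ e)
  Mono {A} f = ∀ {X} (g h : X ⇒ A) → f ∘ g ≈ f ∘ h → g ≈ h

  Epi : ∀ {A B} → A ⇒ B → Set (o ⊔ ℓ ⊔ e)
  Epi {B = B} f = ∀ {X} (g h : B ⇒ X) → g ∘ f ≈ h ∘ f → g ≈ h

  record IsEqualizer {E A B : Obj} (f g : A ⇒ B) (eq : E ⇒ A) : Set (o ⊔ ℓ ⊔ e) where
    field
      equality  : f ∘ eq ≈ g ∘ eq
      equalize  : ∀ {X} {h : X ⇒ A} → f ∘ h ≈ g ∘ h → X ⇒ E
      universal : ∀ {X} {h : X ⇒ A} {p : f ∘ h ≈ g ∘ h} → h ≈ eq ∘ equalize p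
      unique    : ∀ {X} {h : X ⇒ A} {i : X ⇒ E} {p : f ∘ h ≈ g ∘ h} →
                  h ≈ eq ∘ i → i ≈ equalize p

  record IsCoequalizer {A B Q : Obj} (f g : A ⇒ B) (c : B ⇒ Q) : Set (o ⊔ ℓ ⊔ e) where
    field
      equality   : c ∘ f ≈ c ∘ g
      coequalize : ∀ {X} {h : B ⇒ X} → h ∘ f ≈ h ∘ g → Q ⇒ X
      universal  : ∀ {X} {h : B ⇒ X} {p : h ∘ f ≈ h ∘ g} → h ≈ coequalize p ∘ c
      unique     : ∀ {X} {h : B ⇒ X} {i : Q ⇒ X} {p : h ∘ f ≈ h ∘ g} →
                   h ≈ i ∘ c → i ≈ coequalize p

  record IsPullback {P A B D : Obj} (f : A ⇒ D) (g : B ⇒ D)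
                    (p₁ : P ⇒ A) (p₂ : P ⇒ B) : Set (o ⊔ ℓ ⊔ e) where
    field
      commute   : f ∘ p₁ ≈ g ∘ p₂
      universal : ∀ {X} {h₁ : X ⇒ A} {h₂ : X ⇒ B} → f ∘ h₁ ≈ g ∘ h₂ → X ⇒ P
      p₁∘universal : ∀ {X} {h₁ : X ⇒ A} {h₂ : X ⇒ B} {eq : f ∘ h₁ ≈ g ∘ h₂} →
                     p₁ ∘ universal eq ≈ h₁
      p₂∘universal : ∀ {X} {h₁ : X ⇒ A} {h₂ : X ⇒ B} {eq : f ∘ h₁ ≈ g ∘ h₂} →
                     p₂ ∘ universal eq ≈ h₂
      unique    : ∀ {X} {h₁ : X ⇒ A} {h₂ : X ⇒ B} {eq : f ∘ h₁ ≈ g ∘ h₂} {i : X ⇒ P} →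
                  p₁ ∘ i ≈ h₁ → p₂ ∘ i ≈ h₂ → i ≈ universal eq

  IsKernelPair : ∀ {P A D} (f : A ⇒ D) (p₁ p₂ : P ⇒ A) → Set (o ⊔ ℓ ⊔ e)
  IsKernelPair f p₁ p₂ = IsPullback f f p₁ p₂

  RegularEpi : ∀ {B Q} → B ⇒ Q → Set (o ⊔ ℓ ⊔ e)
  RegularEpi {B} c = Σ[ A ∈ Obj ] Σ[ f ∈ A ⇒ B ] Σ[ g ∈ A ⇒ B ] IsCoequalizer f g c

  Reflexive : ∀ {A B} (f g : A ⇒ B) → Set (ℓ ⊔ e)
  Reflexive {A} {B} f g = Σ[ r ∈ B ⇒ A ] ((f ∘ r ≈ id) Σ.× (g ∘ r ≈ id))
    where import Data.Product as Σ

  record Terminal : Set (o ⊔ ℓ ⊔ e) where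
    field
      ⊤      : Obj
      !      : ∀ {A} → A ⇒ ⊤
      !-unique : ∀ {A} (f : A ⇒ ⊤) → f ≈ !

  record Initial : Set (o ⊔ ℓ ⊔ e) where
    field
      ⊥      : Obj
      ¡      : ∀ {A} → ⊥ ⇒ A
      ¡-unique : ∀ {A} (f : ⊥ ⇒ A) → f ≈ ¡

  record BinaryProducts : Set (o ⊔ ℓ ⊔ e) where
    infixr 7 _×_
    field
      _×_     : Obj → Obj → Obj
      π₁      : ∀ {A B} → A × B ⇒ A
      π₂      : ∀ {A B} → A × B ⇒ B
      ⟨_,_⟩   : ∀ {X A B} → X ⇒ A → X ⇒ B → X ⇒ A × B
      project₁ : ∀ {X A B} {f : X ⇒ A} {g : X ⇒ B} → π₁ ∘ ⟨ f , g ⟩ ≈ f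
      project₂ : ∀ {X A B} {f : X ⇒ A} {g : X ⇒ B} → π₂ ∘ ⟨ f , g ⟩ ≈ g
      unique   : ∀ {X A B} {h : X ⇒ A × B} {f : X ⇒ A} {g : X ⇒ B} →
                 π₁ ∘ h ≈ f → π₂ ∘ h ≈ g → ⟨ f , g ⟩ ≈ h
    infixr 7 _⁂_
    _⁂_ : ∀ {A B C D} → A ⇒ B → C ⇒ D → A × C ⇒ B × D
    f ⁂ g = ⟨ f ∘ π₁ , g ∘ π₂ ⟩

  record BinaryCoproducts : Set (o ⊔ ℓ ⊔ e) where
    infixr 6 _+_
    field
      _+_     : Obj → Obj → Obj
      i₁      : ∀ {A B} → A ⇒ A + B
      i₂      : ∀ {A B} → B ⇒ A + B
      [_,_]   : ∀ {A B X} → A ⇒ X → B ⇒ X → A + B ⇒ X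
      inject₁ : ∀ {A B X} {f : A ⇒ X} {g : B ⇒ X} → [ f , g ] ∘ i₁ ≈ f
      inject₂ : ∀ {A B X} {f : A ⇒ X} {g : B ⇒ X} → [ f , g ] ∘ i₂ ≈ g
      unique  : ∀ {A B X} {h : A + B ⇒ X} {f : A ⇒ X} {g : B ⇒ X} →
                h ∘ i₁ ≈ f → h ∘ i₂ ≈ g → [ f , g ] ≈ h
    infixr 6 _+₁_
    _+₁_ : ∀ {A B C D} → A ⇒ B → C ⇒ D → A + C ⇒ B + D
    f +₁ g = [ i₁ ∘ f , i₂ ∘ g ]
    ∇ : ∀ {A} → A + A ⇒ A
    ∇ = [ id , id ]

  record Equalizers : Set (o ⊔ ℓ ⊔ e) where
    field
      equalizerObj : ∀ {A B} (f g : A ⇒ B) → Obj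
      equalizer    : ∀ {A B} (f g : A ⇒ B) → equalizerObj f g ⇒ A
      isEqualizer  : ∀ {A B} (f g : A ⇒ B) → IsEqualizer f g (equalizer f g)

  record Coequalizers : Set (o ⊔ ℓ ⊔ e) where
    field
      coequalizerObj : ∀ {A B} (f g : A ⇒ B) → Obj
      coequalizer    : ∀ {A B} (f g : A ⇒ B) → B ⇒ coequalizerObj f g
      isCoequalizer  : ∀ {A B} (f g : A ⇒ B) → IsCoequalizer f g (coequalizer f g)

  record FiniteLimits : Set (o ⊔ ℓ ⊔ e) where
    field
      terminal  : Terminal
      products  : BinaryProducts
      equalizers : Equalizers

  record FiniteColimits : Set (o ⊔ ℓ ⊔ e) where
    field
      initial    : Initial
      coproducts : BinaryCoproducts
      coequalizers : Coequalizers

  record Regular : Set (o ⊔ ℓ ⊔ e) where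
    field
      finiteLimits : FiniteLimits
      kernelPairCoequalizers :
        ∀ {P A D} (f : A ⇒ D) (p₁ p₂ : P ⇒ A) → IsKernelPair f p₁ p₂ →
        Σ[ Q ∈ Obj ] Σ[ c ∈ A ⇒ Q ] IsCoequalizer p₁ p₂ c
      pullbackStable :
        ∀ {P A B D} {f : A ⇒ D} {g : B ⇒ D} {p₁ : P ⇒ A} {p₂ : P ⇒ B} →
        IsPullback f g p₁ p₂ → RegularEpi f → RegularEpi p₂

  record Endofunctor : Set (o ⊔ ℓ ⊔ e) where
    field
      F₀ : Obj → Obj
      F₁ : ∀ {A B} → A ⇒ B → F₀ A ⇒ F₀ B
      identity     : ∀ {A} → F₁ (id {A}) ≈ id
      homomorphism : ∀ {A B C} {f : A ⇒ B} {g : B ⇒ C} → F₁ (g ∘ f) ≈ F₁ g ∘ F₁ f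
      F-resp-≈     : ∀ {A B} {f g : A ⇒ B} → f ≈ g → F₁ f ≈ F₁ g

  record Bifunctor : Set (o ⊔ ℓ ⊔ e) where
    field
      B₀ : Obj → Obj → Obj
      B₁ : ∀ {A A' X X'} → A' ⇒ A → X ⇒ X' → B₀ A X ⇒ B₀ A' X'
      identity     : ∀ {A X} → B₁ (id {A}) (id {X}) ≈ id
      homomorphism : ∀ {A A' A'' X X' X''} {f : A' ⇒ A} {g : A'' ⇒ A'}
                       {h : X ⇒ X'} {k : X' ⇒ X''} →
                     B₁ (f ∘ g) (k ∘ h) ≈ B₁ g k ∘ B₁ f h
      B-resp-≈     : ∀ {A A' X X'} {f f' : A' ⇒ A} {g g' : X ⇒ X'} →
                     f ≈ f' → g ≈ g' → B₁ f g ≈ B₁ f' g'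

  record FreeAlgebras (F : Endofunctor) : Set (o ⊔ ℓ ⊔ e) where
    open Endofunctor F
    field
      Fr  : Obj → Obj
      α   : ∀ X → F₀ (Fr X) ⇒ Fr X
      η   : ∀ X → X ⇒ Fr X
      ext : ∀ {X A} (a : F₀ A ⇒ A) (f : X ⇒ A) → Fr X ⇒ A
      ext-η   : ∀ {X A} {a : F₀ A ⇒ A} {f : X ⇒ A} → ext a f ∘ η X ≈ f
      ext-hom : ∀ {X A} {a : F₀ A ⇒ A} {f : X ⇒ A} →
                ext a f ∘ α X ≈ a ∘ F₁ (ext a f)
      ext-unique : ∀ {X A} {a : F₀ A ⇒ A} {f : X ⇒ A} {h : Fr X ⇒ A} →
                   h ∘ η X ≈ f → h ∘ α X ≈ a ∘ F₁ h → h ≈ ext a f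

record Setting (o ℓ e : Level) : Set (lsuc (o ⊔ ℓ ⊔ e)) where
  field
    𝒞 : Category o ℓ e
  open Category 𝒞
  open Notions 𝒞
  field
    regular        : Regular
    finiteColimits : FiniteColimits
  open FiniteLimits (Regular.finiteLimits regular)
  open FiniteColimits finiteColimits
  open BinaryProducts products
  open BinaryCoproducts coproducts
  field
    V  : Obj
    Σ' : Endofunctor
    Σ'-free : FreeAlgebras Σ'
  open Endofunctor Σ' renaming (F₀ to Σ'₀; F₁ to Σ'₁)

  Σ₀ : Obj → Obj
  Σ₀ X = V + Σ'₀ X
  Σ₁ : ∀ {X Y} → X ⇒ Y → Σ₀ X ⇒ Σ₀ Y
  Σ₁ f = id +₁ Σ'₁ f

  -- the free monad Σ⋆ : the free Σ-algebra on X is the free Σ'-algebra on V + X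
  open FreeAlgebras Σ'-free
  Σ⋆₀ : Obj → Obj
  Σ⋆₀ X = Fr (V + X)
  Σ⋆₁ : ∀ {X Y} → X ⇒ Y → Σ⋆₀ X ⇒ Σ⋆₀ Y
  Σ⋆₁ {X} {Y} f = ext (α (V + Y)) (η (V + Y) ∘ (id +₁ f))

  field
    Σ-preserves-reflexive-coequalizers :
      ∀ {A B Q} {f g : A ⇒ B} {c : B ⇒ Q} → Reflexive f g →
      IsCoequalizer f g c → IsCoequalizer (Σ₁ f) (Σ₁ g) (Σ₁ c)
    B : Bifunctor
  open Bifunctor B
  field
    B-preserves-monos : ∀ {A A' X X'} {f : A' ⇒ A} {g : X ⇒ X'} →
                        Epi f → Mono g → Mono (B₁ f g)
    -- the V-pointed higher-order GSOS law; an object of V/𝒞 is a pair (X , x)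
    ρ : ∀ (X : Obj) (x : V ⇒ X) (Y : Obj) →
        Σ₀ (X × B₀ X Y) ⇒ B₀ X (Σ⋆₀ (X + Y))
    ρ-dinatural :
      ∀ {X X' : Obj} {x : V ⇒ X} {x' : V ⇒ X'} (f : X ⇒ X') → f ∘ x ≈ x' →
      ∀ (Y : Obj) →
      B₁ id (Σ⋆₁ (f +₁ id)) ∘ ρ X x Y ∘ Σ₁ (id ⁂ B₁ f id)
        ≈ B₁ f id ∘ ρ X' x' Y ∘ Σ₁ (f ⁂ id)
    ρ-natural :
      ∀ (X : Obj) (x : V ⇒ X) {Y Y' : Obj} (g : Y ⇒ Y') →
      B₁ id (Σ⋆₁ (id +₁ g)) ∘ ρ X x Y ≈ ρ X x Y' ∘ Σ₁ (id ⁂ B₁ id g)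

  σ⋆ : ∀ X → Σ₀ (Σ⋆₀ X) ⇒ Σ⋆₀ X
  σ⋆ X = [ η (V + X) ∘ i₁ , α (V + X) ]

  hat : ∀ {A} → Σ₀ A ⇒ A → Σ⋆₀ A ⇒ A
  hat {A} a = ext (a ∘ i₂) [ a ∘ i₁ , id ]

  -- the initial Σ-algebra (μΣ , ι) = free Σ-algebra on the initial object
  μΣ : Obj
  μΣ = Σ⋆₀ (Initial.⊥ initial)
  ι : Σ₀ μΣ ⇒ μΣ
  ι = σ⋆ (Initial.⊥ initial)

  cata : ∀ {A} → Σ₀ A ⇒ A → μΣ ⇒ A
  cata {A} a = ext (a ∘ i₂) [ a ∘ i₁ , Initial.¡ initial ]

  -- a♣ : μΣ → B(A,A), the unique morphism with
  --   a♣ ∘ ι ≈ B(id, â) ∘ B(id, Σ⋆∇) ∘ ρ_{A,A} ∘ Σ⟨(|a|), a♣⟩ ;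
  -- defined as  π₂ ∘ (| ⟨ a ∘ Σπ₁ , B(id, â) ∘ B(id, Σ⋆∇) ∘ ρ_{A,A} ⟩ |)
  clubsuit : ∀ {A} → Σ₀ A ⇒ A → μΣ ⇒ B₀ A A
  clubsuit {A} a =
    π₂ ∘ cata ⟨ a ∘ Σ₁ π₁ , B₁ id (hat a) ∘ B₁ id (Σ⋆₁ ∇) ∘ ρ A (a ∘ i₁) A ⟩

  field
    Z : Obj
    ζ : Z ⇒ B₀ μΣ Z
    coit : ∀ {X} → X ⇒ B₀ μΣ X → X ⇒ Z
    coit-hom : ∀ {X} {k : X ⇒ B₀ μΣ X} → ζ ∘ coit k ≈ B₁ id (coit k) ∘ k
    coit-unique : ∀ {X} {k : X ⇒ B₀ μΣ X} {h : X ⇒ Z} →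
                  ζ ∘ h ≈ B₁ id h ∘ k → h ≈ coit k

  star : ∀ {E} → E ⇒ μΣ → Σ⋆₀ E ⇒ μΣ
  star p = hat ι ∘ Σ⋆₁ p

-- Write ℓ♣ for clubsuit ι. In a regular category coit ℓ♣ factors as m ∘ r with r the quotient by
-- its kernel pair and m mono; as B preserves monos and B(id, m ∘ r) ∘ ℓ♣ = ζ ∘ coit ℓ♣, the map
-- B(id, r) ∘ ℓ♣, and hence B(id, c) ∘ ℓ♣, identifies p₁ and p₂. Naturality of (-)♣ along the
-- algebra morphism c rewrites B(id, c) ∘ ℓ♣ as B(c, id) ∘ ι∼♣, and B(c, id) is mono since c is
-- epi, so ι∼♣ identifies p₁ and p₂. As the second component of the algebra morphism ⟨c, ι∼♣⟩
-- out of μΣ, ι∼♣ then also identifies p₁⋆ and p₂⋆, so it factors through their coequalizer c.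
module Submission where

open import Defs
open import Data.Product using (Σ-syntax; _,_; proj₁; proj₂)
open import Relation.Binary using (Setoid; IsEquivalence)
import Relation.Binary.Reasoning.Setoid as SetoidReasoning

module CategoryProperties {o ℓ e} (C : Category o ℓ e) where
  open Category C
  open Notions C

  module ≈ {A B : Obj} = IsEquivalence (equiv {A} {B})

  hom-setoid : Obj → Obj → Setoid ℓ e
  hom-setoid A B = record { isEquivalence = equiv {A} {B} }

  module HomReasoning {A B : Obj} where
    open SetoidReasoning (hom-setoid A B) public

  infixr 4 _⟩∘⟨_ refl⟩∘⟨_
  infixl 5 _⟩∘⟨refl

  _⟩∘⟨_ : ∀ {A B C} {f h : B ⇒ C} {g i : A ⇒ B} → f ≈ h → g ≈ i → f ∘ g ≈ h ∘ i
  _⟩∘⟨_ = ∘-resp-≈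

  refl⟩∘⟨_ : ∀ {A B C} {f : B ⇒ C} {g i : A ⇒ B} → g ≈ i → f ∘ g ≈ f ∘ i
  refl⟩∘⟨ p = ∘-resp-≈ ≈.refl p

  _⟩∘⟨refl : ∀ {A B C} {f h : B ⇒ C} {g : A ⇒ B} → f ≈ h → f ∘ g ≈ h ∘ g
  p ⟩∘⟨refl = ∘-resp-≈ p ≈.refl

  sym-assoc : ∀ {A B C D} {f : A ⇒ B} {g : B ⇒ C} {h : C ⇒ D} → h ∘ (g ∘ f) ≈ (h ∘ g) ∘ f
  sym-assoc = ≈.sym assoc

  pullʳ : ∀ {W X Y Z} {a : Y ⇒ Z} {b : X ⇒ Y} {c : W ⇒ X} {d : W ⇒ Y} →
          b ∘ c ≈ d → (a ∘ b) ∘ c ≈ a ∘ d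
  pullʳ p = ≈.trans assoc (refl⟩∘⟨ p)

  pullˡ : ∀ {W X Y Z} {a : Y ⇒ Z} {b : X ⇒ Y} {c : W ⇒ X} {d : X ⇒ Z} →
          a ∘ b ≈ d → a ∘ (b ∘ c) ≈ d ∘ c
  pullˡ p = ≈.trans sym-assoc (p ⟩∘⟨refl)

  id-epi : ∀ {A} → Epi (id {A})
  id-epi g h p = ≈.trans (≈.sym identityʳ) (≈.trans p identityʳ)

  id-mono : ∀ {A} → Mono (id {A})
  id-mono g h p = ≈.trans (≈.sym identityˡ) (≈.trans p identityˡ)

  coequalizer⇒epi : ∀ {A B Q} {f g : A ⇒ B} {c : B ⇒ Q} → IsCoequalizer f g c → Epi c
  coequalizer⇒epi {f = f} {g} {c} coeq u v u∘c≈v∘c =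
    ≈.trans (unique {p = u∘c-coequalizes} ≈.refl) (≈.sym (unique {p = u∘c-coequalizes} u∘c≈v∘c))
    where
      open IsCoequalizer coeq
      u∘c-coequalizes : (u ∘ c) ∘ f ≈ (u ∘ c) ∘ g
      u∘c-coequalizes = ≈.trans (pullʳ equality) sym-assoc

  module CoproductProperties (coproducts : BinaryCoproducts) where
    open BinaryCoproducts coproducts renaming (unique to []-unique)

    +-ext : ∀ {A A' X} {h k : A + A' ⇒ X} → h ∘ i₁ ≈ k ∘ i₁ → h ∘ i₂ ≈ k ∘ i₂ → h ≈ k
    +-ext p q = ≈.trans (≈.sym ([]-unique ≈.refl ≈.refl)) ([]-unique (≈.sym p) (≈.sym q))

    []-cong : ∀ {A A' X} {f f' : A ⇒ X} {g g' : A' ⇒ X} → f ≈ f' → g ≈ g' → [ f , g ] ≈ [ f' , g' ]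
    []-cong p q = ≈.sym ([]-unique (≈.trans inject₁ p) (≈.trans inject₂ q))

    ∘[] : ∀ {A A' X Y} {f : A ⇒ X} {g : A' ⇒ X} {h : X ⇒ Y} → h ∘ [ f , g ] ≈ [ h ∘ f , h ∘ g ]
    ∘[] = ≈.sym ([]-unique (pullʳ inject₁) (pullʳ inject₂))

    []∘+₁ : ∀ {A A' X X' Y} {f : X ⇒ Y} {g : X' ⇒ Y} {f' : A ⇒ X} {g' : A' ⇒ X'} →
            [ f , g ] ∘ (f' +₁ g') ≈ [ f ∘ f' , g ∘ g' ]
    []∘+₁ = ≈.trans ∘[] ([]-cong (pullˡ inject₁) (pullˡ inject₂))

    +₁-cong : ∀ {A A' X X'} {f f' : A ⇒ X} {g g' : A' ⇒ X'} → f ≈ f' → g ≈ g' → f +₁ g ≈ f' +₁ g'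
    +₁-cong p q = []-cong (refl⟩∘⟨ p) (refl⟩∘⟨ q)

    +₁∘+₁ : ∀ {A A' X X' Y Y'} {f : X ⇒ Y} {g : X' ⇒ Y'} {f' : A ⇒ X} {g' : A' ⇒ X'} →
            (f +₁ g) ∘ (f' +₁ g') ≈ (f ∘ f') +₁ (g ∘ g')
    +₁∘+₁ = ≈.trans []∘+₁ ([]-cong assoc assoc)

    h∘∇ : ∀ {A X} {h : A ⇒ X} → h ∘ ∇ ≈ [ h , id ] ∘ (id +₁ h)
    h∘∇ = ≈.trans ∘[] (≈.trans ([]-cong ≈.refl (≈.trans identityʳ (≈.sym identityˡ))) (≈.sym []∘+₁))

    ∇∘h+₁id : ∀ {A X} {h : A ⇒ X} → ∇ ∘ (h +₁ id) ≈ [ h , id ]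
    ∇∘h+₁id = ≈.trans []∘+₁ ([]-cong identityˡ identityˡ)

  module ProductProperties (products : BinaryProducts) where
    open BinaryProducts products renaming (unique to ⟨⟩-unique)

    ⟨⟩-ext : ∀ {X A A'} {h k : X ⇒ A × A'} → π₁ ∘ h ≈ π₁ ∘ k → π₂ ∘ h ≈ π₂ ∘ k → h ≈ k
    ⟨⟩-ext p q = ≈.trans (≈.sym (⟨⟩-unique ≈.refl ≈.refl)) (⟨⟩-unique (≈.sym p) (≈.sym q))

    ⟨⟩-cong : ∀ {X A A'} {f f' : X ⇒ A} {g g' : X ⇒ A'} → f ≈ f' → g ≈ g' → ⟨ f , g ⟩ ≈ ⟨ f' , g' ⟩
    ⟨⟩-cong p q = ≈.sym (⟨⟩-unique (≈.trans project₁ p) (≈.trans project₂ q))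

    ⟨⟩∘ : ∀ {W X A A'} {f : X ⇒ A} {g : X ⇒ A'} {h : W ⇒ X} → ⟨ f , g ⟩ ∘ h ≈ ⟨ f ∘ h , g ∘ h ⟩
    ⟨⟩∘ = ≈.sym (⟨⟩-unique (pullˡ project₁) (pullˡ project₂))

module RegularCategoryProperties {o ℓ e} {C : Category o ℓ e} (R : Notions.Regular C) where
  open Category C
  open Notions C
  open CategoryProperties C
  open HomReasoning
  open Regular R
  open FiniteLimits finiteLimits
  open BinaryProducts products using (_×_; π₁; π₂; ⟨_,_⟩; project₁; project₂)
    renaming (unique to ⟨⟩-unique)

  module CanonicalPullback {A A' D} (f : A ⇒ D) (g : A' ⇒ D) where
    open Equalizers equalizers
    open IsEqualizer (isEqualizer (f ∘ π₁) (g ∘ π₂))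

    q₁ : equalizerObj (f ∘ π₁) (g ∘ π₂) ⇒ A
    q₁ = π₁ ∘ equalizer (f ∘ π₁) (g ∘ π₂)

    q₂ : equalizerObj (f ∘ π₁) (g ∘ π₂) ⇒ A'
    q₂ = π₂ ∘ equalizer (f ∘ π₁) (g ∘ π₂)

    pairing-equalizes : ∀ {X} {h₁ : X ⇒ A} {h₂ : X ⇒ A'} → f ∘ h₁ ≈ g ∘ h₂ →
                        (f ∘ π₁) ∘ ⟨ h₁ , h₂ ⟩ ≈ (g ∘ π₂) ∘ ⟨ h₁ , h₂ ⟩
    pairing-equalizes eq = ≈.trans (pullʳ project₁) (≈.trans eq (≈.sym (pullʳ project₂)))

    isPullback : IsPullback f g q₁ q₂
    isPullback = record
      { commute      = ≈.trans sym-assoc (≈.trans equality assoc)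
      ; universal    = λ eq → equalize (pairing-equalizes eq)
      ; p₁∘universal = λ {_} {_} {_} {eq} →
          ≈.trans assoc (≈.trans (refl⟩∘⟨ ≈.sym (universal {p = pairing-equalizes eq})) project₁)
      ; p₂∘universal = λ {_} {_} {_} {eq} →
          ≈.trans assoc (≈.trans (refl⟩∘⟨ ≈.sym (universal {p = pairing-equalizes eq})) project₂)
      ; unique       = λ {_} {_} {_} {eq} p q →
          unique {p = pairing-equalizes eq}
            (⟨⟩-unique (≈.trans sym-assoc p) (≈.trans sym-assoc q))
      }

  -- Pulling the regular epi e back along x and then along y ∘ (that pullback) yields a
  -- common epi r with m ∘ x ∘ r ≈ m ∘ y ∘ r; the kernel pair of f then shows x ∘ r ≈ y ∘ r.
  kernelPairCoequalizer-factor-mono :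
    ∀ {P A D I} {f : A ⇒ D} {p₁ p₂ : P ⇒ A} {e : A ⇒ I} {m : I ⇒ D} →
    IsKernelPair f p₁ p₂ → IsCoequalizer p₁ p₂ e → f ≈ m ∘ e → Mono m
  kernelPairCoequalizer-factor-mono {f = f} {p₁} {p₂} {e} {m} kp coeq f≈m∘e x y m∘x≈m∘y =
    regularEpi⇒epi e₁-regular x y
      (regularEpi⇒epi e₂-regular (x ∘ e₁) (y ∘ e₁) (≈.trans assoc (≈.trans x∘e₁∘e₂≈y∘e₁∘e₂ sym-assoc)))
    where
      regularEpi⇒epi : ∀ {B Q} {c : B ⇒ Q} → RegularEpi c → Epi c
      regularEpi⇒epi (_ , _ , _ , c-coeq) = coequalizer⇒epi c-coeq

      module Along-x = CanonicalPullback e x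
      e₁ = Along-x.q₂
      a₁ = Along-x.q₁
      e₁-regular = pullbackStable Along-x.isPullback (_ , p₁ , p₂ , coeq)

      module Along-y = CanonicalPullback e (y ∘ e₁)
      e₂ = Along-y.q₂
      a₂ = Along-y.q₁
      e₂-regular = pullbackStable Along-y.isPullback (_ , p₁ , p₂ , coeq)

      square₁ : e ∘ a₁ ≈ x ∘ e₁
      square₁ = IsPullback.commute Along-x.isPullback

      square₂ : e ∘ a₂ ≈ (y ∘ e₁) ∘ e₂
      square₂ = IsPullback.commute Along-y.isPullback

      f-identifies : f ∘ (a₁ ∘ e₂) ≈ f ∘ a₂
      f-identifies = begin
        f ∘ (a₁ ∘ e₂)        ≈⟨ f≈m∘e ⟩∘⟨refl ⟩
        (m ∘ e) ∘ (a₁ ∘ e₂)  ≈⟨ ≈.trans assoc (refl⟩∘⟨ pullˡ square₁) ⟩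
        m ∘ ((x ∘ e₁) ∘ e₂)  ≈⟨ ≈.trans (refl⟩∘⟨ assoc) (≈.trans sym-assoc (m∘x≈m∘y ⟩∘⟨refl)) ⟩
        (m ∘ y) ∘ (e₁ ∘ e₂)  ≈⟨ ≈.trans assoc (refl⟩∘⟨ sym-assoc) ⟩
        m ∘ ((y ∘ e₁) ∘ e₂)  ≈⟨ refl⟩∘⟨ square₂ ⟨
        m ∘ (e ∘ a₂)         ≈⟨ ≈.trans (f≈m∘e ⟩∘⟨refl) assoc ⟨
        f ∘ a₂               ∎

      open IsPullback kp using (p₁∘universal; p₂∘universal) renaming (universal to factor)

      x∘e₁∘e₂≈y∘e₁∘e₂ : x ∘ (e₁ ∘ e₂) ≈ y ∘ (e₁ ∘ e₂)
      x∘e₁∘e₂≈y∘e₁∘e₂ = begin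
        x ∘ (e₁ ∘ e₂)                   ≈⟨ ≈.trans (pullˡ square₁) assoc ⟨
        e ∘ (a₁ ∘ e₂)                   ≈⟨ refl⟩∘⟨ p₁∘universal {eq = f-identifies} ⟨
        e ∘ (p₁ ∘ factor f-identifies)  ≈⟨ pullˡ (IsCoequalizer.equality coeq) ⟩
        (e ∘ p₂) ∘ factor f-identifies  ≈⟨ pullʳ (p₂∘universal {eq = f-identifies}) ⟩
        e ∘ a₂                          ≈⟨ ≈.trans square₂ assoc ⟩
        y ∘ (e₁ ∘ e₂)                   ∎

module SettingProperties {o ℓ e} (S : Setting o ℓ e) where
  open Setting S
  open Category 𝒞
  open Notions 𝒞
  open CategoryProperties 𝒞
  open HomReasoning
  open Regular regular using (finiteLimits)
  open FiniteLimits finiteLimits using (products)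
  open FiniteColimits finiteColimits using (initial; coproducts)
  open Initial initial using (¡-unique)
  open BinaryProducts products renaming (unique to ⟨⟩-unique)
  open BinaryCoproducts coproducts
  open CoproductProperties coproducts
  open ProductProperties products
  open FreeAlgebras Σ'-free
  open Endofunctor Σ'
    renaming (F₀ to Σ'₀; F₁ to Σ'₁; homomorphism to Σ'-homomorphism; F-resp-≈ to Σ'-resp-≈)
  open Bifunctor B renaming (homomorphism to B-homomorphism)
  open RegularCategoryProperties regular using (kernelPairCoequalizer-factor-mono)

  Σ₁-homomorphism : ∀ {X Y W} {f : X ⇒ Y} {g : Y ⇒ W} → Σ₁ (g ∘ f) ≈ Σ₁ g ∘ Σ₁ f
  Σ₁-homomorphism = ≈.trans (+₁-cong (≈.sym identityˡ) Σ'-homomorphism) (≈.sym +₁∘+₁)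

  Σ₁-resp-≈ : ∀ {X Y} {f g : X ⇒ Y} → f ≈ g → Σ₁ f ≈ Σ₁ g
  Σ₁-resp-≈ p = +₁-cong ≈.refl (Σ'-resp-≈ p)

  Σ₁∘i₁ : ∀ {X Y} {f : X ⇒ Y} → Σ₁ f ∘ i₁ ≈ i₁
  Σ₁∘i₁ = ≈.trans inject₁ identityʳ

  Σ₁⁂∘Σ₁⟨⟩ : ∀ {X A A' Y Y'} {f : A ⇒ Y} {g : A' ⇒ Y'} {u : X ⇒ A} {v : X ⇒ A'} →
              Σ₁ (f ⁂ g) ∘ Σ₁ ⟨ u , v ⟩ ≈ Σ₁ ⟨ f ∘ u , g ∘ v ⟩
  Σ₁⁂∘Σ₁⟨⟩ = ≈.trans (≈.sym Σ₁-homomorphism) (Σ₁-resp-≈ (≈.trans ⟨⟩∘ (⟨⟩-cong (pullʳ project₁) (pullʳ project₂))))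

  B₁-id∘B₁-id : ∀ {A X Y W} {k : Y ⇒ W} {h : X ⇒ Y} → B₁ (id {A}) k ∘ B₁ id h ≈ B₁ id (k ∘ h)
  B₁-id∘B₁-id = ≈.trans (≈.sym B-homomorphism) (B-resp-≈ identityˡ ≈.refl)

  B₁-id-pull : ∀ {Z A X Y W} {k : Y ⇒ W} {h : X ⇒ Y} {r : Z ⇒ B₀ A X} →
               B₁ id k ∘ (B₁ id h ∘ r) ≈ B₁ id (k ∘ h) ∘ r
  B₁-id-pull = pullˡ B₁-id∘B₁-id

  B₁-swap : ∀ {A A' X Y} {h : A' ⇒ A} {k : X ⇒ Y} → B₁ h id ∘ B₁ id k ≈ B₁ id k ∘ B₁ h id
  B₁-swap = ≈.trans (≈.sym B-homomorphism)
    (≈.trans (B-resp-≈ (≈.trans identityˡ (≈.sym identityʳ)) (≈.trans identityˡ (≈.sym identityʳ))) B-homomorphism)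

  ρ-natural-on : ∀ (X : Obj) (x : V ⇒ X) {Y Y' W} (g : Y ⇒ Y') {u : W ⇒ X} {v : W ⇒ B₀ X Y} →
    B₁ id (Σ⋆₁ (id +₁ g)) ∘ (ρ X x Y ∘ Σ₁ ⟨ u , v ⟩) ≈ ρ X x Y' ∘ Σ₁ ⟨ u , B₁ id g ∘ v ⟩
  ρ-natural-on X x g = begin
    B₁ id (Σ⋆₁ (id +₁ g)) ∘ (ρ X x _ ∘ Σ₁ _)  ≈⟨ pullˡ (ρ-natural X x g) ⟩
    (ρ X x _ ∘ Σ₁ (id ⁂ B₁ id g)) ∘ Σ₁ _     ≈⟨ pullʳ Σ₁⁂∘Σ₁⟨⟩ ⟩
    ρ X x _ ∘ Σ₁ ⟨ id ∘ _ , B₁ id g ∘ _ ⟩     ≈⟨ refl⟩∘⟨ Σ₁-resp-≈ (⟨⟩-cong identityˡ ≈.refl) ⟩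
    ρ X x _ ∘ Σ₁ ⟨ _ , B₁ id g ∘ _ ⟩          ∎

  ρ-dinatural-on : ∀ {X X'} {x : V ⇒ X} {x' : V ⇒ X'} (f : X ⇒ X') → f ∘ x ≈ x' →
    ∀ {Y W} {u : W ⇒ X} {v : W ⇒ B₀ X' Y} →
    B₁ f id ∘ (ρ X' x' Y ∘ Σ₁ ⟨ f ∘ u , v ⟩)
      ≈ B₁ id (Σ⋆₁ (f +₁ id)) ∘ (ρ X x Y ∘ Σ₁ ⟨ u , B₁ f id ∘ v ⟩)
  ρ-dinatural-on {X} {X'} {x} {x'} f f∘x≈x' {Y} {u = u} {v} = begin
    B₁ f id ∘ (ρ X' x' Y ∘ Σ₁ ⟨ f ∘ u , v ⟩)
      ≈⟨ refl⟩∘⟨ refl⟩∘⟨ ≈.trans (Σ₁-resp-≈ (⟨⟩-cong ≈.refl (≈.sym identityˡ))) (≈.sym Σ₁⁂∘Σ₁⟨⟩) ⟩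
    B₁ f id ∘ (ρ X' x' Y ∘ (Σ₁ (f ⁂ id) ∘ Σ₁ ⟨ u , v ⟩))
      ≈⟨ ≈.trans (refl⟩∘⟨ sym-assoc) sym-assoc ⟩
    (B₁ f id ∘ ρ X' x' Y ∘ Σ₁ (f ⁂ id)) ∘ Σ₁ ⟨ u , v ⟩
      ≈⟨ ρ-dinatural f f∘x≈x' Y ⟩∘⟨refl ⟨
    (B₁ id (Σ⋆₁ (f +₁ id)) ∘ ρ X x Y ∘ Σ₁ (id ⁂ B₁ f id)) ∘ Σ₁ ⟨ u , v ⟩
      ≈⟨ ≈.trans assoc (refl⟩∘⟨ assoc) ⟩
    B₁ id (Σ⋆₁ (f +₁ id)) ∘ (ρ X x Y ∘ (Σ₁ (id ⁂ B₁ f id) ∘ Σ₁ ⟨ u , v ⟩))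
      ≈⟨ refl⟩∘⟨ refl⟩∘⟨ ≈.trans Σ₁⁂∘Σ₁⟨⟩ (Σ₁-resp-≈ (⟨⟩-cong identityˡ ≈.refl)) ⟩
    B₁ id (Σ⋆₁ (f +₁ id)) ∘ (ρ X x Y ∘ Σ₁ ⟨ u , B₁ f id ∘ v ⟩)
      ∎

  ext-cong : ∀ {X A} {a : Σ'₀ A ⇒ A} {f f' : X ⇒ A} → f ≈ f' → ext a f ≈ ext a f'
  ext-cong p = ext-unique (≈.trans ext-η p) ext-hom

  ext-fusion : ∀ {X A A'} {a : Σ'₀ A ⇒ A} {b : Σ'₀ A' ⇒ A'} {f : X ⇒ A} {k : A ⇒ A'} →
               k ∘ a ≈ b ∘ Σ'₁ k → k ∘ ext a f ≈ ext b (k ∘ f)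
  ext-fusion k-hom = ext-unique (pullʳ ext-η)
    (≈.trans (pullʳ ext-hom) (≈.trans (pullˡ k-hom) (≈.trans assoc (refl⟩∘⟨ ≈.sym Σ'-homomorphism))))

  ext∘Σ⋆₁ : ∀ {X Y A} {a : Σ'₀ A ⇒ A} {f : V + Y ⇒ A} {g : X ⇒ Y} →
            ext a f ∘ Σ⋆₁ g ≈ ext a (f ∘ (id +₁ g))
  ext∘Σ⋆₁ = ≈.trans (ext-fusion ext-hom) (ext-cong (pullˡ ext-η))

  Σ⋆₁-homomorphism : ∀ {X Y W} {f : X ⇒ Y} {g : Y ⇒ W} → Σ⋆₁ (g ∘ f) ≈ Σ⋆₁ g ∘ Σ⋆₁ f
  Σ⋆₁-homomorphism = ≈.sym (≈.trans ext∘Σ⋆₁ (ext-cong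
    (≈.trans assoc (refl⟩∘⟨ ≈.trans +₁∘+₁ (+₁-cong identityˡ ≈.refl)))))

  Σ⋆₁-resp-≈ : ∀ {X Y} {f g : X ⇒ Y} → f ≈ g → Σ⋆₁ f ≈ Σ⋆₁ g
  Σ⋆₁-resp-≈ p = ext-cong (refl⟩∘⟨ +₁-cong ≈.refl p)

  IsAlgebraMorphism : ∀ {A A'} → Σ₀ A ⇒ A → Σ₀ A' ⇒ A' → A ⇒ A' → Set e
  IsAlgebraMorphism a a' h = h ∘ a ≈ a' ∘ Σ₁ h

  algebraMorphism-preserves-point : ∀ {A A'} {a : Σ₀ A ⇒ A} {a' : Σ₀ A' ⇒ A'} {h : A ⇒ A'} →
    IsAlgebraMorphism a a' h → h ∘ (a ∘ i₁) ≈ a' ∘ i₁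
  algebraMorphism-preserves-point h-hom = ≈.trans (pullˡ h-hom) (pullʳ Σ₁∘i₁)

  hat-natural : ∀ {A A'} {a : Σ₀ A ⇒ A} {a' : Σ₀ A' ⇒ A'} {h : A ⇒ A'} →
    IsAlgebraMorphism a a' h → h ∘ hat a ≈ hat a' ∘ Σ⋆₁ h
  hat-natural {a = a} {a'} {h} h-hom =
    ≈.trans (ext-fusion on-operations) (≈.trans (ext-cong on-generators) (≈.sym ext∘Σ⋆₁))
    where
      on-operations : h ∘ (a ∘ i₂) ≈ (a' ∘ i₂) ∘ Σ'₁ h
      on-operations = ≈.trans (pullˡ h-hom) (≈.trans (pullʳ inject₂) sym-assoc)
      on-generators : h ∘ [ a ∘ i₁ , id ] ≈ [ a' ∘ i₁ , id ] ∘ (id +₁ h)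
      on-generators = ≈.trans ∘[] (≈.trans
        ([]-cong (algebraMorphism-preserves-point h-hom) (≈.trans identityʳ (≈.sym identityˡ)))
        (≈.sym (≈.trans []∘+₁ ([]-cong identityʳ ≈.refl))))

  cata-isAlgebraMorphism : ∀ {A} {a : Σ₀ A ⇒ A} → IsAlgebraMorphism ι a (cata a)
  cata-isAlgebraMorphism = +-ext
    (≈.trans (pullʳ inject₁) (≈.trans (pullˡ ext-η) (≈.trans inject₁ (≈.sym (pullʳ Σ₁∘i₁)))))
    (≈.trans (pullʳ inject₂) (≈.trans ext-hom (≈.trans assoc (≈.sym (pullʳ inject₂)))))

  cata-unique : ∀ {A} {a : Σ₀ A ⇒ A} {g : μΣ ⇒ A} → IsAlgebraMorphism ι a g → g ≈ cata a
  cata-unique {a = a} {g} g-hom = ext-unique on-generators on-operations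
    where
      on-generators : g ∘ η _ ≈ [ a ∘ i₁ , Initial.¡ initial ]
      on-generators = +-ext
        (≈.trans (pullʳ (≈.sym (inject₁ {g = α _}))) (≈.trans (algebraMorphism-preserves-point g-hom) (≈.sym inject₁)))
        (≈.trans (¡-unique _) (≈.sym (¡-unique _)))
      on-operations : g ∘ α _ ≈ (a ∘ i₂) ∘ Σ'₁ g
      on-operations = ≈.trans (refl⟩∘⟨ ≈.sym (inject₂ {f = η _ ∘ i₁}))
        (≈.trans (pullˡ g-hom) (≈.trans (pullʳ inject₂) sym-assoc))

  cata-fusion : ∀ {A A'} {a : Σ₀ A ⇒ A} {a' : Σ₀ A' ⇒ A'} {h : A ⇒ A'} →
    IsAlgebraMorphism a a' h → h ∘ cata a ≈ cata a'
  cata-fusion h-hom = cata-unique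
    (≈.trans (pullʳ cata-isAlgebraMorphism) (≈.trans (pullˡ h-hom) (pullʳ (≈.sym Σ₁-homomorphism))))

  star∘η∘i₂ : ∀ {E} (p : E ⇒ μΣ) → star p ∘ (η (V + E) ∘ i₂) ≈ p
  star∘η∘i₂ p = begin
    (hat ι ∘ Σ⋆₁ p) ∘ (η _ ∘ i₂)   ≈⟨ ≈.trans (pullʳ (pullˡ ext-η)) (refl⟩∘⟨ pullʳ inject₂) ⟩
    hat ι ∘ (η _ ∘ (i₂ ∘ p))       ≈⟨ ≈.trans (pullˡ ext-η) (pullˡ inject₂) ⟩
    id ∘ p                         ≈⟨ identityˡ ⟩
    p                              ∎

  identifies-star⇒identifies : ∀ {X E} {g : μΣ ⇒ X} {p₁ p₂ : E ⇒ μΣ} →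
    g ∘ star p₁ ≈ g ∘ star p₂ → g ∘ p₁ ≈ g ∘ p₂
  identifies-star⇒identifies {p₁ = p₁} {p₂} g-identifies =
    ≈.trans (refl⟩∘⟨ ≈.sym (star∘η∘i₂ p₁)) (≈.trans (pullˡ g-identifies) (pullʳ (star∘η∘i₂ p₂)))

  algebraMorphism∘star : ∀ {A E} {a : Σ₀ A ⇒ A} {g : μΣ ⇒ A} (p : E ⇒ μΣ) →
    IsAlgebraMorphism ι a g → g ∘ star p ≈ hat a ∘ Σ⋆₁ (g ∘ p)
  algebraMorphism∘star p g-hom =
    ≈.trans (pullˡ (hat-natural g-hom)) (pullʳ (≈.sym Σ⋆₁-homomorphism))

  -- clubsuit a unfolds to rec a (B₁ id (hat a) ∘ B₁ id (Σ⋆₁ ∇) ∘ ρ A (a ∘ i₁) A).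
  rec : ∀ {A X} → Σ₀ A ⇒ A → Σ₀ (A × X) ⇒ X → μΣ ⇒ X
  rec a k = π₂ ∘ cata ⟨ a ∘ Σ₁ π₁ , k ⟩

  cata-pairing : ∀ {A X} {a : Σ₀ A ⇒ A} {k : Σ₀ (A × X) ⇒ X} →
    cata ⟨ a ∘ Σ₁ π₁ , k ⟩ ≈ ⟨ cata a , rec a k ⟩
  cata-pairing = ≈.sym (⟨⟩-unique (cata-fusion project₁) ≈.refl)

  rec-equation : ∀ {A X} {a : Σ₀ A ⇒ A} {k : Σ₀ (A × X) ⇒ X} →
    rec a k ∘ ι ≈ k ∘ Σ₁ ⟨ cata a , rec a k ⟩
  rec-equation = ≈.trans (pullʳ cata-isAlgebraMorphism)
    (≈.trans (pullˡ project₂) (refl⟩∘⟨ Σ₁-resp-≈ cata-pairing))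

  rec-unique : ∀ {A X} {a : Σ₀ A ⇒ A} {k : Σ₀ (A × X) ⇒ X} {w : μΣ ⇒ X} →
    w ∘ ι ≈ k ∘ Σ₁ ⟨ cata a , w ⟩ → w ≈ rec a k
  rec-unique {a = a} {k} {w} w-equation =
    ≈.trans (≈.sym project₂) (refl⟩∘⟨ cata-unique pairing-isAlgebraMorphism)
    where
      pairing-isAlgebraMorphism : IsAlgebraMorphism ι ⟨ a ∘ Σ₁ π₁ , k ⟩ ⟨ cata a , w ⟩
      pairing-isAlgebraMorphism = ⟨⟩-ext
        (≈.trans (pullˡ project₁) (≈.trans cata-isAlgebraMorphism
          (≈.trans (refl⟩∘⟨ Σ₁-resp-≈ (≈.sym project₁)) (≈.trans (refl⟩∘⟨ Σ₁-homomorphism)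
            (≈.trans sym-assoc (≈.sym (pullˡ project₁)))))))
        (≈.trans (pullˡ project₂) (≈.trans w-equation (≈.sym (pullˡ project₂))))

  rec∘star : ∀ {A X E} {a : Σ₀ A ⇒ A} {k : Σ₀ (A × X) ⇒ X} {p₁ p₂ : E ⇒ μΣ} →
    cata a ∘ p₁ ≈ cata a ∘ p₂ → rec a k ∘ p₁ ≈ rec a k ∘ p₂ →
    rec a k ∘ star p₁ ≈ rec a k ∘ star p₂
  rec∘star {a = a} {k} {p₁} {p₂} cata-identifies rec-identifies = begin
    (π₂ ∘ G) ∘ star p₁                         ≈⟨ pullʳ (algebraMorphism∘star p₁ cata-isAlgebraMorphism) ⟩
    π₂ ∘ (hat _ ∘ Σ⋆₁ (G ∘ p₁))               ≈⟨ refl⟩∘⟨ refl⟩∘⟨ Σ⋆₁-resp-≈ G-identifies ⟩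
    π₂ ∘ (hat _ ∘ Σ⋆₁ (G ∘ p₂))               ≈⟨ pullʳ (algebraMorphism∘star p₂ cata-isAlgebraMorphism) ⟨
    (π₂ ∘ G) ∘ star p₂                         ∎
    where
      G = cata ⟨ a ∘ Σ₁ π₁ , k ⟩
      G∘ : ∀ p → G ∘ p ≈ ⟨ cata a ∘ p , rec a k ∘ p ⟩
      G∘ p = ≈.trans (cata-pairing ⟩∘⟨refl) ⟨⟩∘
      G-identifies : G ∘ p₁ ≈ G ∘ p₂
      G-identifies = ≈.trans (G∘ p₁) (≈.trans (⟨⟩-cong cata-identifies rec-identifies) (≈.sym (G∘ p₂)))

  clubsuit-natural : ∀ {A A'} {a : Σ₀ A ⇒ A} {a' : Σ₀ A' ⇒ A'} {h : A ⇒ A'} →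
    IsAlgebraMorphism a a' h → B₁ h id ∘ clubsuit a' ≈ B₁ id h ∘ clubsuit a
  clubsuit-natural {A} {A'} {a} {a'} {h} h-hom =
    ≈.trans (rec-unique contravariant-equation) (≈.sym (rec-unique covariant-equation))
    where
      -- Both sides satisfy the recursion equation of this step, so rec-unique identifies them.
      mixed-step : Σ₀ (A × B₀ A A') ⇒ B₀ A A'
      mixed-step = B₁ id (hat a' ∘ Σ⋆₁ [ h , id ]) ∘ ρ A (a ∘ i₁) A'

      h∘hat∘Σ⋆₁∇ : h ∘ (hat a ∘ Σ⋆₁ ∇) ≈ (hat a' ∘ Σ⋆₁ [ h , id ]) ∘ Σ⋆₁ (id +₁ h)
      h∘hat∘Σ⋆₁∇ = begin
        h ∘ (hat a ∘ Σ⋆₁ ∇)                            ≈⟨ pullˡ (hat-natural h-hom) ⟩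
        (hat a' ∘ Σ⋆₁ h) ∘ Σ⋆₁ ∇                       ≈⟨ pullʳ (≈.sym Σ⋆₁-homomorphism) ⟩
        hat a' ∘ Σ⋆₁ (h ∘ ∇)                           ≈⟨ refl⟩∘⟨ Σ⋆₁-resp-≈ h∘∇ ⟩
        hat a' ∘ Σ⋆₁ ([ h , id ] ∘ (id +₁ h))          ≈⟨ ≈.trans (refl⟩∘⟨ Σ⋆₁-homomorphism) sym-assoc ⟩
        (hat a' ∘ Σ⋆₁ [ h , id ]) ∘ Σ⋆₁ (id +₁ h)      ∎

      covariant-equation : (B₁ id h ∘ clubsuit a) ∘ ι
                             ≈ mixed-step ∘ Σ₁ ⟨ cata a , B₁ id h ∘ clubsuit a ⟩
      covariant-equation = begin
        (B₁ id h ∘ clubsuit a) ∘ ι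
          ≈⟨ pullʳ rec-equation ⟩
        B₁ id h ∘ (B₁ id (hat a) ∘ B₁ id (Σ⋆₁ ∇) ∘ ρ A _ A) ∘ Σ₁ ⟨ cata a , clubsuit a ⟩
          ≈⟨ refl⟩∘⟨ ≈.trans assoc (refl⟩∘⟨ assoc) ⟩
        B₁ id h ∘ B₁ id (hat a) ∘ B₁ id (Σ⋆₁ ∇) ∘ ρ A _ A ∘ Σ₁ ⟨ cata a , clubsuit a ⟩
          ≈⟨ ≈.trans (refl⟩∘⟨ B₁-id-pull) B₁-id-pull ⟩
        B₁ id (h ∘ (hat a ∘ Σ⋆₁ ∇)) ∘ ρ A _ A ∘ Σ₁ ⟨ cata a , clubsuit a ⟩
          ≈⟨ B-resp-≈ ≈.refl h∘hat∘Σ⋆₁∇ ⟩∘⟨refl ⟩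
        B₁ id ((hat a' ∘ Σ⋆₁ [ h , id ]) ∘ Σ⋆₁ (id +₁ h)) ∘ ρ A _ A ∘ Σ₁ ⟨ cata a , clubsuit a ⟩
          ≈⟨ B₁-id-pull ⟨
        B₁ id (hat a' ∘ Σ⋆₁ [ h , id ]) ∘ B₁ id (Σ⋆₁ (id +₁ h)) ∘ ρ A _ A ∘ Σ₁ ⟨ cata a , clubsuit a ⟩
          ≈⟨ refl⟩∘⟨ ρ-natural-on A (a ∘ i₁) h ⟩
        B₁ id (hat a' ∘ Σ⋆₁ [ h , id ]) ∘ ρ A _ A' ∘ Σ₁ ⟨ cata a , B₁ id h ∘ clubsuit a ⟩
          ≈⟨ sym-assoc ⟩
        mixed-step ∘ Σ₁ ⟨ cata a , B₁ id h ∘ clubsuit a ⟩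
          ∎

      contravariant-equation : (B₁ h id ∘ clubsuit a') ∘ ι
                                 ≈ mixed-step ∘ Σ₁ ⟨ cata a , B₁ h id ∘ clubsuit a' ⟩
      contravariant-equation = begin
        (B₁ h id ∘ clubsuit a') ∘ ι
          ≈⟨ pullʳ rec-equation ⟩
        B₁ h id ∘ (B₁ id (hat a') ∘ B₁ id (Σ⋆₁ ∇) ∘ ρ A' _ A') ∘ Σ₁ ⟨ cata a' , clubsuit a' ⟩
          ≈⟨ refl⟩∘⟨ ≈.trans assoc (≈.trans (refl⟩∘⟨ assoc) B₁-id-pull) ⟩
        B₁ h id ∘ B₁ id (hat a' ∘ Σ⋆₁ ∇) ∘ ρ A' _ A' ∘ Σ₁ ⟨ cata a' , clubsuit a' ⟩
          ≈⟨ ≈.trans sym-assoc (≈.trans (B₁-swap ⟩∘⟨refl) assoc) ⟩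
        B₁ id (hat a' ∘ Σ⋆₁ ∇) ∘ B₁ h id ∘ ρ A' _ A' ∘ Σ₁ ⟨ cata a' , clubsuit a' ⟩
          ≈⟨ refl⟩∘⟨ refl⟩∘⟨ refl⟩∘⟨ Σ₁-resp-≈ (⟨⟩-cong (cata-fusion h-hom) ≈.refl) ⟨
        B₁ id (hat a' ∘ Σ⋆₁ ∇) ∘ B₁ h id ∘ ρ A' _ A' ∘ Σ₁ ⟨ h ∘ cata a , clubsuit a' ⟩
          ≈⟨ refl⟩∘⟨ ρ-dinatural-on h (algebraMorphism-preserves-point h-hom) ⟩
        B₁ id (hat a' ∘ Σ⋆₁ ∇) ∘ B₁ id (Σ⋆₁ (h +₁ id)) ∘ ρ A _ A' ∘ Σ₁ ⟨ cata a , B₁ h id ∘ clubsuit a' ⟩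
          ≈⟨ B₁-id-pull ⟩
        B₁ id ((hat a' ∘ Σ⋆₁ ∇) ∘ Σ⋆₁ (h +₁ id)) ∘ ρ A _ A' ∘ Σ₁ ⟨ cata a , B₁ h id ∘ clubsuit a' ⟩
          ≈⟨ B-resp-≈ ≈.refl (pullʳ (≈.trans (≈.sym Σ⋆₁-homomorphism) (Σ⋆₁-resp-≈ ∇∘h+₁id))) ⟩∘⟨refl ⟩
        B₁ id (hat a' ∘ Σ⋆₁ [ h , id ]) ∘ ρ A _ A' ∘ Σ₁ ⟨ cata a , B₁ h id ∘ clubsuit a' ⟩
          ≈⟨ sym-assoc ⟩
        mixed-step ∘ Σ₁ ⟨ cata a , B₁ h id ∘ clubsuit a' ⟩
          ∎

  -- Through the image factorisation coit k = m ∘ r: B(μΣ, m) is mono, and B(μΣ, m ∘ r) ∘ k = ζ ∘ coit k.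
  coit-kernelPair-behaviour : ∀ {X P Y} {k : X ⇒ B₀ μΣ X} {p₁ p₂ : P ⇒ X} {c : X ⇒ Y} →
    IsKernelPair (coit k) p₁ p₂ → c ∘ p₁ ≈ c ∘ p₂ → B₁ id c ∘ k ∘ p₁ ≈ B₁ id c ∘ k ∘ p₂
  coit-kernelPair-behaviour {X} {P} {Y} {k} {p₁} {p₂} {c} kp c-identifies = begin
    B₁ id c ∘ k ∘ p₁                   ≈⟨ via-r p₁ ⟩
    B₁ id c' ∘ B₁ id r ∘ k ∘ p₁        ≈⟨ refl⟩∘⟨ r-identifies ⟩
    B₁ id c' ∘ B₁ id r ∘ k ∘ p₂        ≈⟨ via-r p₂ ⟨
    B₁ id c ∘ k ∘ p₂                   ∎
    where
      kernelPair-quotient : Σ[ I ∈ Obj ] Σ[ r ∈ X ⇒ I ] IsCoequalizer p₁ p₂ r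
      kernelPair-quotient = Regular.kernelPairCoequalizers regular (coit k) p₁ p₂ kp
      I : Obj
      I = proj₁ kernelPair-quotient
      r : X ⇒ I
      r = proj₁ (proj₂ kernelPair-quotient)
      r-coequalizer : IsCoequalizer p₁ p₂ r
      r-coequalizer = proj₂ (proj₂ kernelPair-quotient)
      open IsCoequalizer r-coequalizer using (coequalize; universal)
      m : I ⇒ Z
      m = coequalize (IsPullback.commute kp)
      c' : I ⇒ Y
      c' = coequalize c-identifies

      coit-through-m : ∀ p → B₁ id m ∘ B₁ id r ∘ k ∘ p ≈ ζ ∘ coit k ∘ p
      coit-through-m p = begin
        B₁ id m ∘ B₁ id r ∘ k ∘ p   ≈⟨ B₁-id-pull ⟩
        B₁ id (m ∘ r) ∘ k ∘ p       ≈⟨ B-resp-≈ ≈.refl universal ⟩∘⟨refl ⟨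
        B₁ id (coit k) ∘ k ∘ p      ≈⟨ ≈.trans (pullˡ coit-hom) assoc ⟨
        ζ ∘ coit k ∘ p              ∎

      r-identifies : B₁ id r ∘ k ∘ p₁ ≈ B₁ id r ∘ k ∘ p₂
      r-identifies = B-preserves-monos id-epi
        (kernelPairCoequalizer-factor-mono kp r-coequalizer universal) _ _
        (≈.trans (coit-through-m p₁)
          (≈.trans (refl⟩∘⟨ IsPullback.commute kp) (≈.sym (coit-through-m p₂))))

      via-r : ∀ p → B₁ id c ∘ k ∘ p ≈ B₁ id c' ∘ B₁ id r ∘ k ∘ p
      via-r p = ≈.trans (B-resp-≈ ≈.refl universal ⟩∘⟨refl) (≈.sym B₁-id-pull)

lemma4p15 : ∀ {o ℓ e} (S : Setting o ℓ e) →
    let open Setting S in let open Category 𝒞 in let open Notions 𝒞 in let open Bifunctor B in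
    ∀ {E : Obj} (p₁ p₂ : E ⇒ μΣ) → IsKernelPair (coit (clubsuit ι)) p₁ p₂ →
    ∀ {Q : Obj} (c : μΣ ⇒ Q) → IsCoequalizer (star p₁) (star p₂) c →
    ∀ (ι∼ : Σ₀ Q ⇒ Q) → ι∼ ∘ Σ₁ c ≈ c ∘ ι →
    Σ[ ς ∈ Q ⇒ B₀ Q Q ] ς ∘ c ≈ clubsuit ι∼
lemma4p15 S p₁ p₂ kp c coeq ι∼ c-hom = coequalize ♣-coequalizes , ≈.sym universal
  where
    open Setting S
    open Category 𝒞
    open Notions 𝒞
    open Bifunctor B
    open CategoryProperties 𝒞
    open HomReasoning
    open SettingProperties S
    open IsCoequalizer coeq

    c-isAlgebraMorphism : IsAlgebraMorphism ι ι∼ c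
    c-isAlgebraMorphism = ≈.sym c-hom

    c-identifies : c ∘ p₁ ≈ c ∘ p₂
    c-identifies = identifies-star⇒identifies equality

    ♣-identifies : clubsuit ι∼ ∘ p₁ ≈ clubsuit ι∼ ∘ p₂
    ♣-identifies = B-preserves-monos (coequalizer⇒epi coeq) id-mono _ _ (begin
      B₁ c id ∘ clubsuit ι∼ ∘ p₁  ≈⟨ ≈.trans (pullˡ (clubsuit-natural c-isAlgebraMorphism)) assoc ⟩
      B₁ id c ∘ clubsuit ι ∘ p₁   ≈⟨ coit-kernelPair-behaviour kp c-identifies ⟩
      B₁ id c ∘ clubsuit ι ∘ p₂   ≈⟨ ≈.trans (pullˡ (clubsuit-natural c-isAlgebraMorphism)) assoc ⟨
      B₁ c id ∘ clubsuit ι∼ ∘ p₂  ∎)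

    cata-identifies : cata ι∼ ∘ p₁ ≈ cata ι∼ ∘ p₂
    cata-identifies = ≈.trans (≈.sym c≈cata ⟩∘⟨refl) (≈.trans c-identifies (c≈cata ⟩∘⟨refl))
      where
        c≈cata : c ≈ cata ι∼
        c≈cata = cata-unique c-isAlgebraMorphism

    ♣-coequalizes : clubsuit ι∼ ∘ star p₁ ≈ clubsuit ι∼ ∘ star p₂
    ♣-coequalizes = rec∘star cata-identifies ♣-identifies
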